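{- Every algebra of $\mathbb{RL}^B$ satisfies $B(x\vee\neg x)\le Bx\vee\neg x$ for all elements $x$.
   Context: A residuated lattice is an algebra $(A;\wedge,\vee,\cdot,\to,0,1)$ with $(A;\wedge,\vee,0,1)$ a bounded lattice ($0$ least, $1$ greatest), $(A;\cdot,1)$ a commutative monoid, and $a\cdot b\le c$ iff $a\le b\to c$; $\neg a=a\to0$. $\mathbb{RL}^B$ is the class of residuated lattices expanded with a unary operation $B$ such that for all $a,b$: $Ba\le a$, $Ba\vee\neg Ba=1$, and if $b\le a$ and $b\vee\neg b=1$ then $b\le Ba$. -}

module Defs where

open import Level using (Level; suc; _⊔_)
open import Relation.Binary.Core using (Rel)
open import Algebra.Core using (Op₁; Op₂)
open import Algebra.Structures using (IsCommutativeMonoid)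
open import Algebra.Lattice.Structures using (IsLattice)

record RLB (c ℓ : Level) : Set (suc (c ⊔ ℓ)) where
  infix  4 _≈_ _≤_
  infixr 5 _⇒_
  infixr 6 _∨_
  infixr 7 _∧_
  infixl 8 _·_
  field
    Carrier : Set c
    _≈_     : Rel Carrier ℓ
    _∧_     : Op₂ Carrier
    _∨_     : Op₂ Carrier
    _·_     : Op₂ Carrier
    _⇒_     : Op₂ Carrier
    𝟘       : Carrier
    𝟙       : Carrier
    B       : Op₁ Carrier

  _≤_ : Carrier → Carrier → Set ℓ
  a ≤ b = (a ∧ b) ≈ a

  ¬_ : Op₁ Carrier
  ¬ a = a ⇒ 𝟘

  field
    isLattice   : IsLattice _≈_ _∨_ _∧_
    𝟘-least     : ∀ a → 𝟘 ≤ a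
    𝟙-greatest  : ∀ a → a ≤ 𝟙
    ·-isCommutativeMonoid : IsCommutativeMonoid _≈_ _·_ 𝟙
    ⇒-cong      : ∀ {a a' b b'} → a ≈ a' → b ≈ b' → (a ⇒ b) ≈ (a' ⇒ b')
    residuation-to   : ∀ {a b c} → (a · b) ≤ c → a ≤ (b ⇒ c)
    residuation-from : ∀ {a b c} → a ≤ (b ⇒ c) → (a · b) ≤ c
    B-cong      : ∀ {a b} → a ≈ b → B a ≈ B b
    B-deflationary : ∀ a → B a ≤ a
    B-complemented : ∀ a → (B a ∨ ¬ B a) ≈ 𝟙
    B-greatest     : ∀ a b → b ≤ a → (b ∨ ¬ b) ≈ 𝟙 → b ≤ B a

-- Let b = B (x ∨ ¬ x). Since b is complemented it is idempotent, so
-- b ≤ b · (x ∨ ¬ x) ≤ b · x ∨ b · ¬ x. The element b · x is again complemented: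
-- its negation lies above ¬ b and above b · ¬ x, hence above the complement of
-- b · x inside b. Being complemented and below x, b · x ≤ B x, while b · ¬ x ≤ ¬ x.
module Submission where

open import Defs
open import Level using (Level)
open import Data.Product using (_,_)
open import Algebra.Structures using (IsCommutativeMonoid)
open import Algebra.Lattice.Structures using (IsLattice)
open import Algebra.Lattice.Bundles using (Lattice)
import Algebra.Lattice.Properties.Lattice as LatticeProperties
open import Relation.Binary.Structures using (IsPartialOrder)
import Relation.Binary.Lattice as Order
import Relation.Binary.Lattice.Properties.JoinSemilattice as JoinSemilatticeProperties
import Relation.Binary.Reasoning.PartialOrder as ≤-Reasoning

module RLBProperties {c ℓ : Level} (A : RLB c ℓ) where
  open RLB A
  open IsLattice isLattice using (isEquivalence; sym)
  open IsCommutativeMonoid ·-isCommutativeMonoid using ()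
    renaming ( assoc to ·-assoc; comm to ·-comm; ∙-congˡ to ·-congˡ
             ; identityˡ to ·-identityˡ; identityʳ to ·-identityʳ )

  lattice : Lattice c ℓ
  lattice = record { isLattice = isLattice }

  -- The library orders a lattice by  a ≈ a ∧ b ; RLB uses the symmetric  a ∧ b ≈ a.
  private
    module Natural = Order.IsLattice (LatticeProperties.∨-∧-isOrderTheoreticLattice lattice)

  ≤-isPartialOrder : IsPartialOrder _≈_ _≤_
  ≤-isPartialOrder = record
    { isPreorder = record
      { isEquivalence = isEquivalence
      ; reflexive     = λ a≈b → sym (Natural.reflexive a≈b)
      ; trans         = λ a≤b b≤d → sym (Natural.trans (sym a≤b) (sym b≤d))
      }
    ; antisym = λ a≤b b≤a → Natural.antisym (sym a≤b) (sym b≤a)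
    }

  ∨-isJoinSemilattice : Order.IsJoinSemilattice _≈_ _≤_ _∨_
  ∨-isJoinSemilattice = record
    { isPartialOrder = ≤-isPartialOrder
    ; supremum       = λ a b →
        let a≤a∨b , b≤a∨b , least = Natural.supremum a b
        in sym a≤a∨b , sym b≤a∨b , λ d a≤d b≤d → sym (least d (sym a≤d) (sym b≤d))
    }

  joinSemilattice : Order.JoinSemilattice c ℓ ℓ
  joinSemilattice = record { isJoinSemilattice = ∨-isJoinSemilattice }

  open Order.JoinSemilattice joinSemilattice public
    using (poset; x≤x∨y; y≤x∨y; ∨-least)
    renaming (refl to ≤-refl; reflexive to ≤-reflexive; trans to ≤-trans; antisym to ≤-antisym)
  open JoinSemilatticeProperties joinSemilattice public using (∨-monotonic)

  ·-monoˡ-≤ : ∀ {a b d} → a ≤ b → a · d ≤ b · d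
  ·-monoˡ-≤ a≤b = residuation-from (≤-trans a≤b (residuation-to ≤-refl))

  ·-monoʳ-≤ : ∀ {a b d} → a ≤ b → d · a ≤ d · b
  ·-monoʳ-≤ {a} {b} {d} a≤b = begin
    d · a  ≈⟨ ·-comm d a ⟩
    a · d  ≤⟨ ·-monoˡ-≤ a≤b ⟩
    b · d  ≈⟨ ·-comm b d ⟩
    d · b  ∎
    where open ≤-Reasoning poset

  ·-mono-≤ : ∀ {a b a' b'} → a ≤ a' → b ≤ b' → a · b ≤ a' · b'
  ·-mono-≤ a≤a' b≤b' = ≤-trans (·-monoˡ-≤ a≤a') (·-monoʳ-≤ b≤b')

  ·-distribˡ-∨ : ∀ a u v → a · (u ∨ v) ≤ a · u ∨ a · v
  ·-distribˡ-∨ a u v = begin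
    a · (u ∨ v)  ≈⟨ ·-comm a (u ∨ v) ⟩
    (u ∨ v) · a  ≤⟨ residuation-from (∨-least
                      (residuation-to (≤-trans (≤-reflexive (·-comm u a)) (x≤x∨y _ _)))
                      (residuation-to (≤-trans (≤-reflexive (·-comm v a)) (y≤x∨y _ _)))) ⟩
    a · u ∨ a · v ∎
    where open ≤-Reasoning poset

  x·y≤y : ∀ a b → a · b ≤ b
  x·y≤y a b = ≤-trans (·-monoˡ-≤ (𝟙-greatest a)) (≤-reflexive (·-identityˡ b))

  ¬x·x≤𝟘 : ∀ a → ¬ a · a ≤ 𝟘
  ¬x·x≤𝟘 a = residuation-from ≤-refl

  x·¬x≤𝟘 : ∀ a → a · ¬ a ≤ 𝟘
  x·¬x≤𝟘 a = ≤-trans (≤-reflexive (·-comm a (¬ a))) (¬x·x≤𝟘 a)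

  ¬x≤¬[x·y] : ∀ a b → ¬ a ≤ ¬ (a · b)
  ¬x≤¬[x·y] a b = residuation-to (begin
    ¬ a · (a · b)  ≈⟨ ·-assoc (¬ a) a b ⟨
    ¬ a · a · b    ≤⟨ ·-monoˡ-≤ (¬x·x≤𝟘 a) ⟩
    𝟘 · b          ≤⟨ residuation-from (𝟘-least (b ⇒ 𝟘)) ⟩
    𝟘              ∎)
    where open ≤-Reasoning poset

  Complemented : Carrier → Set ℓ
  Complemented a = a ∨ ¬ a ≈ 𝟙

  complemented⇒idempotent : ∀ {a} → Complemented a → a ≤ a · a
  complemented⇒idempotent {a} a∨¬a≈𝟙 = begin
    a                ≈⟨ ·-identityʳ a ⟨
    a · 𝟙            ≈⟨ ·-congˡ (sym a∨¬a≈𝟙) ⟩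
    a · (a ∨ ¬ a)    ≤⟨ ·-distribˡ-∨ a a (¬ a) ⟩
    a · a ∨ a · ¬ a  ≤⟨ ∨-least ≤-refl (≤-trans (x·¬x≤𝟘 a) (𝟘-least (a · a))) ⟩
    a · a            ∎
    where open ≤-Reasoning poset

  complemented-split : ∀ {a b} → Complemented a → a ≤ b ∨ ¬ b → a ≤ a · b ∨ a · ¬ b
  complemented-split {a} {b} a-compl a≤b∨¬b = begin
    a                ≤⟨ complemented⇒idempotent a-compl ⟩
    a · a            ≤⟨ ·-monoʳ-≤ a≤b∨¬b ⟩
    a · (b ∨ ¬ b)    ≤⟨ ·-distribˡ-∨ a b (¬ b) ⟩
    a · b ∨ a · ¬ b  ∎
    where open ≤-Reasoning poset

  complemented-· : ∀ {a b} → Complemented a → a ≤ b ∨ ¬ b → Complemented (a · b)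
  complemented-· {a} {b} a-compl a≤b∨¬b = ≤-antisym (𝟙-greatest _) (begin
    𝟙                          ≈⟨ a-compl ⟨
    a ∨ ¬ a                    ≤⟨ ∨-monotonic (complemented-split a-compl a≤b∨¬b) (¬x≤¬[x·y] a b) ⟩
    (a · b ∨ a · ¬ b) ∨ ¬ (a · b)
                               ≤⟨ ∨-least (∨-least (x≤x∨y _ _) (≤-trans a·¬b≤¬[a·b] (y≤x∨y _ _))) (y≤x∨y _ _) ⟩
    a · b ∨ ¬ (a · b)          ∎)
    where
    open ≤-Reasoning poset
    a·¬b≤¬[a·b] : a · ¬ b ≤ ¬ (a · b)
    a·¬b≤¬[a·b] = residuation-to (≤-trans (·-mono-≤ (x·y≤y a (¬ b)) (x·y≤y a b)) (¬x·x≤𝟘 b))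

  B[x∨¬x]≤Bx∨¬x : ∀ x → B (x ∨ ¬ x) ≤ B x ∨ ¬ x
  B[x∨¬x]≤Bx∨¬x x = begin
    b                ≤⟨ complemented-split b-compl b≤x∨¬x ⟩
    b · x ∨ b · ¬ x  ≤⟨ ∨-monotonic (B-greatest x (b · x) (x·y≤y b x) (complemented-· b-compl b≤x∨¬x))
                                    (x·y≤y b (¬ x)) ⟩
    B x ∨ ¬ x        ∎
    where
    open ≤-Reasoning poset
    b : Carrier
    b = B (x ∨ ¬ x)
    b-compl : Complemented b
    b-compl = B-complemented (x ∨ ¬ x)
    b≤x∨¬x : b ≤ x ∨ ¬ x
    b≤x∨¬x = B-deflationary (x ∨ ¬ x)

proposition9 : ∀ {c ℓ : Level} (A : RLB c ℓ) → let open RLB A in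
    ∀ x → B (x ∨ ¬ x) ≤ (B x ∨ ¬ x)
proposition9 A = RLBProperties.B[x∨¬x]≤Bx∨¬x A
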